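{- Let $p$ be a prime number, $V = (\mathbb{Z}/p^2\mathbb{Z})^2$, and $\lambda \in (\mathbb{Z}/p^2\mathbb{Z})^\ast$ of order dividing $p-1$. Let $G$ be the subgroup of $\mathrm{GL}_2(\mathbb{Z}/p^2\mathbb{Z})$ generated by $$\begin{pmatrix} \lambda & 0 \\ 0 & 1 \end{pmatrix}, \quad \begin{pmatrix} 1+p & 0 \\ 0 & 1-p \end{pmatrix}, \quad \begin{pmatrix} 1 & p \\ 0 & 1 \end{pmatrix}.$$ Then $H^1_{\mathrm{loc}}(G, V) \neq 0$.
   Context: $G$ acts on $V$ by matrix multiplication. For a group $\Gamma$ and a $\Gamma$-module $M$, a cocycle $Z \colon \Gamma \to M$ satisfies the local conditions if for every $\gamma \in \Gamma$ there exists $m_\gamma \in M$ with $Z_\gamma = \gamma(m_\gamma) - m_\gamma$; $H^1_{\mathrm{loc}}(\Gamma, M)$ is the subgroup of $H^1(\Gamma, M)$ of classes of such cocycles. -}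

module Defs where

open import Data.Nat using (ℕ; zero; suc; _+_; _*_; _∸_; NonZero; NonTrivial; nonTrivial⇒nonZero)
open import Data.Nat.Properties using (m*n≢0)
open import Data.Nat.DivMod using (_mod_)
open import Data.Nat.Primality using (Prime; prime⇒nonZero)
open import Data.Fin using (Fin; toℕ)
open import Data.Product using (_×_; _,_; ∃)
open import Data.Sum using (_⊎_)
open import Relation.Binary.PropositionalEquality using (_≡_)
open import Relation.Nullary using (¬_)

prime⇒sq-nonZero : ∀ {p} → Prime p → NonZero (p * p)
prime⇒sq-nonZero {p} pr = m*n≢0 p p {{prime⇒nonZero pr}} {{prime⇒nonZero pr}}

module ZMod (n : ℕ) .{{nz : NonZero n}} where

  R : Set
  R = Fin n

  [_] : ℕ → R
  [ a ] = a mod n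

  infixl 6 _+R_
  infixl 7 _*R_

  _+R_ : R → R → R
  a +R b = [ toℕ a + toℕ b ]

  _*R_ : R → R → R
  a *R b = [ toℕ a * toℕ b ]

  -R_ : R → R
  -R a = [ n ∸ toℕ a ]

  _-R_ : R → R → R
  a -R b = a +R (-R b)

  0R 1R : R
  0R = [ 0 ]
  1R = [ 1 ]

  _^R_ : R → ℕ → R
  a ^R zero = 1R
  a ^R suc k = a *R (a ^R k)

  IsUnit : R → Set
  IsUnit a = ∃ λ b → a *R b ≡ 1R

  record M2 : Set where
    constructor mat
    field
      e11 e12 e21 e22 : R
  open M2 public

  _·_ : M2 → M2 → M2
  g · h = mat (e11 g *R e11 h +R e12 g *R e21 h) (e11 g *R e12 h +R e12 g *R e22 h)
              (e21 g *R e11 h +R e22 g *R e21 h) (e21 g *R e12 h +R e22 g *R e22 h)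

  I₂ : M2
  I₂ = mat 1R 0R 0R 1R

  V : Set
  V = R × R

  _+V_ : V → V → V
  (x , y) +V (x' , y') = (x +R x' , y +R y')

  _-V_ : V → V → V
  (x , y) -V (x' , y') = (x -R x' , y -R y')

  act : M2 → V → V
  act g (x , y) = (e11 g *R x +R e12 g *R y , e21 g *R x +R e22 g *R y)

  data Gen (S : M2 → Set) : M2 → Set where
    gen : ∀ {g} → S g → Gen S g
    one : Gen S I₂
    mul : ∀ {g h} → Gen S g → Gen S h → Gen S (g · h)
    inv : ∀ {g h} → Gen S g → g · h ≡ I₂ → h · g ≡ I₂ → Gen S h

  -- For a subgroup G (given as a predicate on matrices) and Z : G → V
  -- (represented as a function on all matrices; only values on G matter):
  IsCocycle : (M2 → Set) → (M2 → V) → Set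
  IsCocycle G Z = ∀ g h → G g → G h → Z (g · h) ≡ Z g +V act g (Z h)

  IsCoboundary : (M2 → Set) → (M2 → V) → Set
  IsCoboundary G Z = ∃ λ m → ∀ g → G g → Z g ≡ act g m -V m

  SatisfiesLocal : (M2 → Set) → (M2 → V) → Set
  SatisfiesLocal G Z = ∀ g → G g → ∃ λ m → Z g ≡ act g m -V m

  H1loc≢0 : (M2 → Set) → Set
  H1loc≢0 G = ∃ λ (Z : M2 → V) → IsCocycle G Z × SatisfiesLocal G Z × ¬ IsCoboundary G Z

module Lemma10Setup (p : ℕ) (pr : Prime p) where
  open ZMod (p * p) {{prime⇒sq-nonZero pr}} public

  Gens : R → M2 → Set
  Gens l g = (g ≡ mat l 0R 0R 1R)
           ⊎ (g ≡ mat [ 1 + p ] 0R 0R (1R -R [ p ]))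
           ⊎ (g ≡ mat 1R [ p ] 0R 1R)

module Submission where

-- Let π = p in R = ℤ/p²ℤ, so π² = 0, and let Z(g) = (g₁₂, 0) be the
-- upper-right entry of g placed in the first coordinate.  Every element of
-- G is a "Borel" matrix g = (a, πt; 0, 1 + πs) with a a unit and a(1 + πs) a
-- (p-1)-st root of unity: the generators are, and such matrices form a group.
-- On Borel matrices
--  * Z is a cocycle, because πt(1 + πs') = πt;
--  * Z is not a coboundary: if Z(g) = g m - m with m = (x, y), then the
--    generator (1, π; 0, 1) gives π = πy and (1 + p, 0; 0, 1 - p) gives πy = 0;
--  * Z is locally trivial: if π ∣ s, then m = (0, 1) works; otherwise s is a
--    unit (ℤ/p²ℤ is local) and m = (x, 0) with (a - 1)x = πt works, taking
--    x = πt(a - 1)⁻¹ if a - 1 is a unit, and x = -ts⁻¹ if a = 1 + πr, since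
--    then 1 + π(r + s) is a (p-1)-st root of unity while
--    (1 + πq)^(p-1) = 1 - πq, so πr = -πs.

open import Defs
open import Data.Nat using (ℕ; _∸_)
open import Data.Nat.Primality using (Prime)
open import Relation.Binary.PropositionalEquality using (_≡_)

open import Algebra.Bundles using (CommutativeRing)
open import Algebra.Structures using (IsCommutativeRing)
open import Data.Empty using (⊥-elim)
open import Data.Fin using (toℕ)
open import Data.Fin.Properties using (toℕ-injective; toℕ-fromℕ<; toℕ<n)
open import Data.Nat as ℕ using (zero; suc; NonZero; _%_)
open import Data.Nat.Coprimality using (Coprime; coprime-Bézout)
open import Data.Nat.Divisibility using (_∣?_; divides)
open import Data.Nat.DivMod using (m<n⇒m%n≡m; %-distribˡ-+; %-distribˡ-*; n%n≡0; m*n%n≡0)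
open import Data.Nat.GCD using (module Bézout)
open import Data.Nat.Primality using (prime⇒irreducible; prime⇒nonZero; prime⇒nonTrivial)
import Data.Nat.Properties as ℕ
open import Data.Product using (_,_; proj₁; proj₂; ∃)
open import Data.Sum using (_⊎_; inj₁; inj₂)
open import Relation.Binary.PropositionalEquality
  using (refl; sym; trans; cong; cong₂; subst; subst₂; isEquivalence; module ≡-Reasoning)
open import Relation.Nullary using (¬_; yes; no)

-- The residue map [_] : ℕ → ℤ/nℤ is onto and
-- turns + and * of ℕ into _+R_ and _*R_, so every ring law is inherited
-- from ℕ.
module ZModRing (n : ℕ) .{{_ : NonZero n}} where
  open ZMod n

  toℕ-[] : ∀ m → toℕ [ m ] ≡ m % n
  toℕ-[] m = toℕ-fromℕ< _

  []-toℕ : ∀ a → [ toℕ a ] ≡ a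
  []-toℕ a = toℕ-injective (trans (toℕ-[] (toℕ a)) (m<n⇒m%n≡m (toℕ<n a)))

  []-cong-% : ∀ {m k} → m % n ≡ k % n → [ m ] ≡ [ k ]
  []-cong-% e = toℕ-injective (trans (toℕ-[] _) (trans e (sym (toℕ-[] _))))

  []-homo-+ : ∀ m k → [ m ] +R [ k ] ≡ [ m ℕ.+ k ]
  []-homo-+ m k = []-cong-%
    (trans (cong₂ (λ x y → (x ℕ.+ y) % n) (toℕ-[] m) (toℕ-[] k)) (sym (%-distribˡ-+ m k n)))

  []-homo-* : ∀ m k → [ m ] *R [ k ] ≡ [ m ℕ.* k ]
  []-homo-* m k = []-cong-%
    (trans (cong₂ (λ x y → (x ℕ.* y) % n) (toℕ-[] m) (toℕ-[] k)) (sym (%-distribˡ-* m k n)))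

  [n]≡0 : [ n ] ≡ 0R
  [n]≡0 = []-cong-% (trans (n%n≡0 n) (sym (m*n%n≡0 0 n)))

  by-residues₁ : {P : R → Set} → (∀ x → P [ x ]) → ∀ a → P a
  by-residues₁ {P} f a = subst P ([]-toℕ a) (f (toℕ a))

  by-residues₂ : {P : R → R → Set} → (∀ x y → P [ x ] [ y ]) → ∀ a b → P a b
  by-residues₂ {P} f a b = subst₂ P ([]-toℕ a) ([]-toℕ b) (f (toℕ a) (toℕ b))

  by-residues₃ : {P : R → R → R → Set} → (∀ x y z → P [ x ] [ y ] [ z ]) → ∀ a b c → P a b c
  by-residues₃ {P} f a b c =
    subst (P a b) ([]-toℕ c) (by-residues₂ {λ a b → P a b [ toℕ c ]} (λ x y → f x y (toℕ c)) a b)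

  +R-assoc : ∀ a b c → (a +R b) +R c ≡ a +R (b +R c)
  +R-assoc = by-residues₃ λ x y z → begin
    ([ x ] +R [ y ]) +R [ z ]  ≡⟨ cong (_+R [ z ]) ([]-homo-+ x y) ⟩
    [ x ℕ.+ y ] +R [ z ]       ≡⟨ []-homo-+ (x ℕ.+ y) z ⟩
    [ x ℕ.+ y ℕ.+ z ]          ≡⟨ cong [_] (ℕ.+-assoc x y z) ⟩
    [ x ℕ.+ (y ℕ.+ z) ]        ≡⟨ []-homo-+ x (y ℕ.+ z) ⟨
    [ x ] +R [ y ℕ.+ z ]       ≡⟨ cong ([ x ] +R_) ([]-homo-+ y z) ⟨
    [ x ] +R ([ y ] +R [ z ])  ∎
    where open ≡-Reasoning

  *R-assoc : ∀ a b c → (a *R b) *R c ≡ a *R (b *R c)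
  *R-assoc = by-residues₃ λ x y z → begin
    ([ x ] *R [ y ]) *R [ z ]  ≡⟨ cong (_*R [ z ]) ([]-homo-* x y) ⟩
    [ x ℕ.* y ] *R [ z ]       ≡⟨ []-homo-* (x ℕ.* y) z ⟩
    [ x ℕ.* y ℕ.* z ]          ≡⟨ cong [_] (ℕ.*-assoc x y z) ⟩
    [ x ℕ.* (y ℕ.* z) ]        ≡⟨ []-homo-* x (y ℕ.* z) ⟨
    [ x ] *R [ y ℕ.* z ]       ≡⟨ cong ([ x ] *R_) ([]-homo-* y z) ⟨
    [ x ] *R ([ y ] *R [ z ])  ∎
    where open ≡-Reasoning

  +R-comm : ∀ a b → a +R b ≡ b +R a
  +R-comm = by-residues₂ λ x y →
    trans ([]-homo-+ x y) (trans (cong [_] (ℕ.+-comm x y)) (sym ([]-homo-+ y x)))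

  *R-comm : ∀ a b → a *R b ≡ b *R a
  *R-comm = by-residues₂ λ x y →
    trans ([]-homo-* x y) (trans (cong [_] (ℕ.*-comm x y)) (sym ([]-homo-* y x)))

  +R-identityˡ : ∀ a → 0R +R a ≡ a
  +R-identityˡ = by-residues₁ λ x → []-homo-+ 0 x

  *R-identityˡ : ∀ a → 1R *R a ≡ a
  *R-identityˡ = by-residues₁ λ x → trans ([]-homo-* 1 x) (cong [_] (ℕ.*-identityˡ x))

  *R-distribˡ : ∀ a b c → a *R (b +R c) ≡ a *R b +R a *R c
  *R-distribˡ = by-residues₃ λ x y z → begin
    [ x ] *R ([ y ] +R [ z ])          ≡⟨ cong ([ x ] *R_) ([]-homo-+ y z) ⟩
    [ x ] *R [ y ℕ.+ z ]               ≡⟨ []-homo-* x (y ℕ.+ z) ⟩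
    [ x ℕ.* (y ℕ.+ z) ]                ≡⟨ cong [_] (ℕ.*-distribˡ-+ x y z) ⟩
    [ x ℕ.* y ℕ.+ x ℕ.* z ]            ≡⟨ []-homo-+ (x ℕ.* y) (x ℕ.* z) ⟨
    [ x ℕ.* y ] +R [ x ℕ.* z ]         ≡⟨ cong₂ _+R_ ([]-homo-* x y) ([]-homo-* x z) ⟨
    [ x ] *R [ y ] +R [ x ] *R [ z ]   ∎
    where open ≡-Reasoning

  -R-inverseʳ : ∀ a → a +R (-R a) ≡ 0R
  -R-inverseʳ a = begin
    a +R (-R a)                   ≡⟨ cong (_+R -R a) ([]-toℕ a) ⟨
    [ toℕ a ] +R [ n ∸ toℕ a ]    ≡⟨ []-homo-+ (toℕ a) (n ∸ toℕ a) ⟩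
    [ toℕ a ℕ.+ (n ∸ toℕ a) ]     ≡⟨ cong [_] (ℕ.m+[n∸m]≡n (ℕ.<⇒≤ (toℕ<n a))) ⟩
    [ n ]                         ≡⟨ [n]≡0 ⟩
    0R                            ∎
    where open ≡-Reasoning

  isCommutativeRing : IsCommutativeRing _≡_ _+R_ _*R_ (λ a → -R a) 0R 1R
  isCommutativeRing = record
    { isRing = record
      { +-isAbelianGroup = record
        { isGroup = record
          { isMonoid = record
            { isSemigroup = record
              { isMagma = record { isEquivalence = isEquivalence ; ∙-cong = cong₂ _+R_ }
              ; assoc = +R-assoc }
            ; identity = +R-identityˡ , λ a → trans (+R-comm a 0R) (+R-identityˡ a) }
          ; inverse = (λ a → trans (+R-comm (-R a) a) (-R-inverseʳ a)) , -R-inverseʳ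
          ; ⁻¹-cong = cong (λ a → -R a) }
        ; comm = +R-comm }
      ; *-cong = cong₂ _*R_
      ; *-assoc = *R-assoc
      ; *-identity = *R-identityˡ , λ a → trans (*R-comm a 1R) (*R-identityˡ a)
      ; distrib = *R-distribˡ , λ a b c → begin
          (b +R c) *R a       ≡⟨ *R-comm (b +R c) a ⟩
          a *R (b +R c)       ≡⟨ *R-distribˡ a b c ⟩
          a *R b +R a *R c    ≡⟨ cong₂ _+R_ (*R-comm a b) (*R-comm a c) ⟩
          b *R a +R c *R a    ∎
      }
    ; *-comm = *R-comm }
    where open ≡-Reasoning

  commutativeRing : CommutativeRing _ _
  commutativeRing = record { isCommutativeRing = isCommutativeRing }

  -- derived ring laws and the semiring solver (negations are treated as atoms)
  open import Algebra.Properties.Ring (CommutativeRing.ring commutativeRing) public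
    using (-‿distribˡ-*; -‿distribʳ-*; -1*x≈-x; -0#≈0#; -‿involutive; xyx⁻¹≈y; x≈z//y;
           +-inverseˡ-unique; +-inverseʳ-unique; +-identityʳ-unique)
  open CommutativeRing commutativeRing public using (zeroˡ; zeroʳ; +-identityʳ; *-identityʳ)
  open import Algebra.Solver.Ring.NaturalCoefficients.Default
    (CommutativeRing.commutativeSemiring commutativeRing) public
    using (solve; _:=_; _:+_; _:*_; con)

  IsRootOfUnity : ℕ → R → Set
  IsRootOfUnity k x = x ^R k ≡ 1R

  ^R-distrib-*R : ∀ k x y → (x *R y) ^R k ≡ x ^R k *R y ^R k
  ^R-distrib-*R zero    x y = sym (*R-identityˡ 1R)
  ^R-distrib-*R (suc k) x y = begin
    (x *R y) *R (x *R y) ^R k       ≡⟨ cong ((x *R y) *R_) (^R-distrib-*R k x y) ⟩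
    (x *R y) *R (x ^R k *R y ^R k)  ≡⟨ solve 4 (λ x y X Y → (x :* y) :* (X :* Y) := (x :* X) :* (y :* Y))
                                         refl x y (x ^R k) (y ^R k) ⟩
    (x *R x ^R k) *R (y *R y ^R k)  ∎
    where open ≡-Reasoning

  1^R : ∀ k → 1R ^R k ≡ 1R
  1^R zero    = refl
  1^R (suc k) = trans (cong (1R *R_) (1^R k)) (*R-identityˡ 1R)

  root-*R : ∀ k x y → IsRootOfUnity k x → IsRootOfUnity k y → IsRootOfUnity k (x *R y)
  root-*R k x y xᵏ≡1 yᵏ≡1 =
    trans (^R-distrib-*R k x y) (trans (cong₂ _*R_ xᵏ≡1 yᵏ≡1) (*R-identityˡ 1R))

  root-inverse : ∀ k x y → x *R y ≡ 1R → IsRootOfUnity k x → IsRootOfUnity k y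
  root-inverse k x y xy≡1 xᵏ≡1 = begin
    y ^R k            ≡⟨ *R-identityˡ (y ^R k) ⟨
    1R *R y ^R k      ≡⟨ cong (_*R y ^R k) xᵏ≡1 ⟨
    x ^R k *R y ^R k  ≡⟨ ^R-distrib-*R k x y ⟨
    (x *R y) ^R k     ≡⟨ cong (_^R k) xy≡1 ⟩
    1R ^R k           ≡⟨ 1^R k ⟩
    1R                ∎
    where open ≡-Reasoning

module SquareZero (n : ℕ) .{{_ : NonZero n}}
                  (π : ZMod.R n) (π²≡0 : ZMod._*R_ n π π ≡ ZMod.0R n) where
  open ZMod n
  open ZModRing n
  open ≡-Reasoning

  π∣_ : R → Set
  π∣ x = ∃ λ s → x ≡ π *R s

  π²-vanishes : ∀ x y → x +R (π *R π) *R y ≡ x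
  π²-vanishes x y = begin
    x +R (π *R π) *R y  ≡⟨ cong (λ w → x +R w *R y) π²≡0 ⟩
    x +R 0R *R y        ≡⟨ solve 2 (λ x y → x :+ con 0 :* y := x) refl x y ⟩
    x                   ∎

  1+π0≡1 : 1R +R π *R 0R ≡ 1R
  1+π0≡1 = trans (cong (1R +R_) (zeroʳ π)) (+-identityʳ 1R)

  1+π-*R : ∀ q r → (1R +R π *R q) *R (1R +R π *R r) ≡ 1R +R π *R (q +R r)
  1+π-*R q r = begin
    (1R +R π *R q) *R (1R +R π *R r)               ≡⟨ solve 3 (λ π q r →
                                                        (con 1 :+ π :* q) :* (con 1 :+ π :* r)
                                                        := (con 1 :+ π :* (q :+ r)) :+ (π :* π) :* (q :* r))
                                                        refl π q r ⟩
    (1R +R π *R (q +R r)) +R (π *R π) *R (q *R r)  ≡⟨ π²-vanishes _ _ ⟩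
    1R +R π *R (q +R r)                            ∎

  1+π-^R : ∀ k q → (1R +R π *R q) ^R k ≡ 1R +R [ k ] *R (π *R q)
  1+π-^R zero    q = solve 2 (λ π q → con 1 := con 1 :+ con 0 :* (π :* q)) refl π q
  1+π-^R (suc k) q = begin
    (1R +R π *R q) *R (1R +R π *R q) ^R k        ≡⟨ cong ((1R +R π *R q) *R_) (1+π-^R k q) ⟩
    (1R +R π *R q) *R (1R +R [ k ] *R (π *R q))  ≡⟨ solve 3 (λ π q K →
                                                     (con 1 :+ π :* q) :* (con 1 :+ K :* (π :* q))
                                                     := (con 1 :+ (con 1 :+ K) :* (π :* q)) :+ (π :* π) :* (K :* q :* q))
                                                     refl π q [ k ] ⟩
    (1R +R (1R +R [ k ]) *R (π *R q)) +R (π *R π) *R ([ k ] *R q *R q)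
                                                 ≡⟨ π²-vanishes _ _ ⟩
    1R +R (1R +R [ k ]) *R (π *R q)              ≡⟨ cong (λ w → 1R +R w *R (π *R q)) ([]-homo-+ 1 k) ⟩
    1R +R [ suc k ] *R (π *R q)                  ∎

  -- If (k+1)π = 0, then (1 + πq)^k = 1 - πq, so the only k-th root of unity
  -- in 1 + πR is 1.
  1+π-root-trivial : ∀ k q → [ suc k ] *R π ≡ 0R → IsRootOfUnity k (1R +R π *R q) → π *R q ≡ 0R
  1+π-root-trivial k q [k+1]π≡0 root = begin
    π *R q                       ≡⟨ +-identityʳ (π *R q) ⟨
    π *R q +R 0R                 ≡⟨ cong (π *R q +R_) kπq≡0 ⟨
    π *R q +R [ k ] *R (π *R q)  ≡⟨ solve 3 (λ π q K → π :* q :+ K :* (π :* q) := (con 1 :+ K) :* π :* q)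
                                      refl π q [ k ] ⟩
    (1R +R [ k ]) *R π *R q      ≡⟨ cong (λ w → w *R π *R q) ([]-homo-+ 1 k) ⟩
    [ suc k ] *R π *R q          ≡⟨ cong (_*R q) [k+1]π≡0 ⟩
    0R *R q                      ≡⟨ zeroˡ q ⟩
    0R                           ∎
    where
    kπq≡0 : [ k ] *R (π *R q) ≡ 0R
    kπq≡0 = +-identityʳ-unique 1R _ (trans (sym (1+π-^R k q)) root)

  -- 1 + πq has inverse 1 - πq, so an element that is a unit modulo π is a unit.
  unit-mod-π : ∀ x w q → x *R w ≡ 1R +R π *R q → IsUnit x
  unit-mod-π x w q xw≡1+πq = w *R (1R +R π *R (-R q)) , (begin
    x *R (w *R (1R +R π *R (-R q)))        ≡⟨ *R-assoc x w _ ⟨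
    (x *R w) *R (1R +R π *R (-R q))        ≡⟨ cong (_*R (1R +R π *R (-R q))) xw≡1+πq ⟩
    (1R +R π *R q) *R (1R +R π *R (-R q))  ≡⟨ 1+π-*R q (-R q) ⟩
    1R +R π *R (q +R -R q)                 ≡⟨ cong (λ w → 1R +R π *R w) (-R-inverseʳ q) ⟩
    1R +R π *R 0R                          ≡⟨ 1+π0≡1 ⟩
    1R                                     ∎)

  1+π-inverse : ∀ s v → (1R +R π *R s) *R v ≡ 1R → v ≡ 1R +R π *R (-R (s *R v))
  1+π-inverse s v dv≡1 = begin
    v                          ≡⟨ x≈z//y v (π *R (s *R v)) 1R v+πsv≡1 ⟩
    1R +R -R (π *R (s *R v))   ≡⟨ cong (1R +R_) (-‿distribʳ-* π (s *R v)) ⟩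
    1R +R π *R (-R (s *R v))   ∎
    where
    v+πsv≡1 : v +R π *R (s *R v) ≡ 1R
    v+πsv≡1 = trans (solve 3 (λ π s v → v :+ π :* (s :* v) := (con 1 :+ π :* s) :* v) refl π s v) dv≡1

module BorelCocycle (n : ℕ) .{{_ : NonZero n}}
                    (π : ZMod.R n) (π²≡0 : ZMod._*R_ n π π ≡ ZMod.0R n) (k : ℕ) where
  open ZMod n
  open ZModRing n
  open SquareZero n π π²≡0
  open ≡-Reasoning

  record IsBorel (g : M2) : Set where
    constructor borel
    field
      lower-left      : e21 g ≡ 0R
      upper-right     : π∣ e12 g
      lower-right     : ∃ λ s → e22 g ≡ 1R +R π *R s
      upper-left-unit : IsUnit (e11 g)
      diagonal-root   : IsRootOfUnity k (e11 g *R e22 g)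

  borel-I₂ : IsBorel I₂
  borel-I₂ = borel refl (0R , sym (zeroʳ π)) (0R , sym 1+π0≡1) (1R , *R-identityˡ 1R)
                   (trans (cong (_^R k) (*R-identityˡ 1R)) (1^R k))

  borel-· : ∀ g h → IsBorel g → IsBorel h → IsBorel (g · h)
  borel-· (mat a _ _ _) (mat a' _ _ _) (borel refl (t , refl) (s , refl) (w , aw≡1) root)
                                       (borel refl (t' , refl) (s' , refl) (w' , a'w'≡1) root') =
    borel (solve 3 (λ a' π s → con 0 :* a' :+ (con 1 :+ π :* s) :* con 0 := con 0) refl a' π s)
          (a *R t' +R t , upper-right)
          (s +R s' , lower-right)
          (w *R w' , upper-left-unit)
          (subst (IsRootOfUnity k) diagonal (root-*R k _ _ root root'))
    where
    upper-right : a *R (π *R t') +R (π *R t) *R (1R +R π *R s') ≡ π *R (a *R t' +R t)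
    upper-right = begin
      a *R (π *R t') +R (π *R t) *R (1R +R π *R s')  ≡⟨ solve 5 (λ a π t t' s' →
                                                          a :* (π :* t') :+ (π :* t) :* (con 1 :+ π :* s')
                                                          := π :* (a :* t' :+ t) :+ (π :* π) :* (t :* s'))
                                                          refl a π t t' s' ⟩
      π *R (a *R t' +R t) +R (π *R π) *R (t *R s')   ≡⟨ π²-vanishes _ _ ⟩
      π *R (a *R t' +R t)                            ∎
    lower-right : 0R *R (π *R t') +R (1R +R π *R s) *R (1R +R π *R s') ≡ 1R +R π *R (s +R s')
    lower-right = trans (solve 4 (λ π t' d d' → con 0 :* (π :* t') :+ d :* d' := d :* d')
                          refl π t' (1R +R π *R s) (1R +R π *R s'))
                        (1+π-*R s s')
    upper-left-unit : (a *R a' +R (π *R t) *R 0R) *R (w *R w') ≡ 1R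
    upper-left-unit = begin
      (a *R a' +R (π *R t) *R 0R) *R (w *R w')  ≡⟨ solve 5 (λ a a' πt w w' →
                                                     (a :* a' :+ πt :* con 0) :* (w :* w') := (a :* w) :* (a' :* w'))
                                                     refl a a' (π *R t) w w' ⟩
      (a *R w) *R (a' *R w')                    ≡⟨ cong₂ _*R_ aw≡1 a'w'≡1 ⟩
      1R *R 1R                                  ≡⟨ *R-identityˡ 1R ⟩
      1R                                        ∎
    diagonal : (a *R (1R +R π *R s)) *R (a' *R (1R +R π *R s'))
             ≡ (a *R a' +R (π *R t) *R 0R) *R (0R *R (π *R t') +R (1R +R π *R s) *R (1R +R π *R s'))
    diagonal = solve 6 (λ a a' πt πt' d d' → (a :* d) :* (a' :* d') := (a :* a' :+ πt :* con 0) :* (con 0 :* πt' :+ d :* d'))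
                 refl a a' (π *R t) (π *R t') (1R +R π *R s) (1R +R π *R s')

  borel-inverse : ∀ g h → IsBorel g → g · h ≡ I₂ → h · g ≡ I₂ → IsBorel h
  borel-inverse (mat a _ _ _) (mat e f u v) (borel refl (t , refl) (s , refl) (w , aw≡1) root) gh≡I hg≡I =
    borel u≡0 (-R (w *R t *R v) , f≡π[-wtv]) (-R (s *R v) , 1+π-inverse s v dv≡1)
          (a , trans (*R-comm e a) ae≡1) (root-inverse k (a *R d) (e *R v) ad·ev≡1 root)
    where
    d : R
    d = 1R +R π *R s
    u≡0 : u ≡ 0R
    u≡0 = begin
      u                          ≡⟨ *-identityʳ u ⟨
      u *R 1R                    ≡⟨ cong (u *R_) aw≡1 ⟨
      u *R (a *R w)              ≡⟨ solve 4 (λ u a w v → u :* (a :* w) := (u :* a :+ v :* con 0) :* w) refl u a w v ⟩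
      (u *R a +R v *R 0R) *R w   ≡⟨ cong (λ x → x *R w) (cong e21 hg≡I) ⟩
      0R *R w                    ≡⟨ zeroˡ w ⟩
      0R                         ∎
    ae≡1 : a *R e ≡ 1R
    ae≡1 = begin
      a *R e                       ≡⟨ solve 3 (λ a e πt → a :* e := a :* e :+ πt :* con 0) refl a e (π *R t) ⟩
      a *R e +R (π *R t) *R 0R     ≡⟨ cong (λ x → a *R e +R (π *R t) *R x) u≡0 ⟨
      a *R e +R (π *R t) *R u      ≡⟨ cong e11 gh≡I ⟩
      1R                           ∎
    dv≡1 : d *R v ≡ 1R
    dv≡1 = trans (solve 3 (λ f d v → d :* v := con 0 :* f :+ d :* v) refl f d v) (cong e22 gh≡I)
    af≡-πtv : a *R f ≡ -R ((π *R t) *R v)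
    af≡-πtv = +-inverseˡ-unique (a *R f) _ (cong e12 gh≡I)
    f≡π[-wtv] : f ≡ π *R (-R (w *R t *R v))
    f≡π[-wtv] = begin
      f                             ≡⟨ *R-identityˡ f ⟨
      1R *R f                       ≡⟨ cong (_*R f) aw≡1 ⟨
      (a *R w) *R f                 ≡⟨ solve 3 (λ a w f → (a :* w) :* f := w :* (a :* f)) refl a w f ⟩
      w *R (a *R f)                 ≡⟨ cong (w *R_) af≡-πtv ⟩
      w *R (-R ((π *R t) *R v))     ≡⟨ -‿distribʳ-* w _ ⟨
      -R (w *R ((π *R t) *R v))     ≡⟨ cong -R_ (solve 4 (λ w π t v → w :* ((π :* t) :* v) := π :* (w :* t :* v))
                                                   refl w π t v) ⟩
      -R (π *R (w *R t *R v))       ≡⟨ -‿distribʳ-* π _ ⟩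
      π *R (-R (w *R t *R v))       ∎
    ad·ev≡1 : (a *R d) *R (e *R v) ≡ 1R
    ad·ev≡1 = begin
      (a *R d) *R (e *R v)  ≡⟨ solve 4 (λ a d e v → (a :* d) :* (e :* v) := (a :* e) :* (d :* v)) refl a d e v ⟩
      (a *R e) *R (d *R v)  ≡⟨ cong₂ _*R_ ae≡1 dv≡1 ⟩
      1R *R 1R              ≡⟨ *R-identityˡ 1R ⟩
      1R                    ∎

  generated-borel : (S : M2 → Set) → (∀ g → S g → IsBorel g) → ∀ g → Gen S g → IsBorel g
  generated-borel S S⊆B g (gen Sg)          = S⊆B g Sg
  generated-borel S S⊆B _ one               = borel-I₂
  generated-borel S S⊆B _ (mul Gg Gh)       = borel-· _ _ (generated-borel S S⊆B _ Gg) (generated-borel S S⊆B _ Gh)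
  generated-borel S S⊆B _ (inv Gg gh≡I hg≡I) = borel-inverse _ _ (generated-borel S S⊆B _ Gg) gh≡I hg≡I

  triangular : R → R → R → M2
  triangular a t s = mat a (π *R t) 0R (1R +R π *R s)

  Z : M2 → V
  Z g = e12 g , 0R

  -- Z(gh) = Z(g) + g Z(h) on Borel matrices, because πt(1 + πs') = πt.
  Z-cocycle : ∀ g h → IsBorel g → IsBorel h → Z (g · h) ≡ Z g +V act g (Z h)
  Z-cocycle (mat a _ _ _) (mat a' _ _ _) (borel refl (t , refl) (s , refl) _ _)
                                         (borel refl (t' , refl) (s' , refl) _ _) =
    cong₂ _,_ first (solve 3 (λ π t' d → con 0 := con 0 :+ (con 0 :* (π :* t') :+ d :* con 0))
                       refl π t' (1R +R π *R s))
    where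
    first : a *R (π *R t') +R (π *R t) *R (1R +R π *R s') ≡ π *R t +R (a *R (π *R t') +R (π *R t) *R 0R)
    first = begin
      a *R (π *R t') +R (π *R t) *R (1R +R π *R s')
        ≡⟨ solve 5 (λ a π t t' s' → a :* (π :* t') :+ (π :* t) :* (con 1 :+ π :* s')
                      := (π :* t :+ (a :* (π :* t') :+ (π :* t) :* con 0)) :+ (π :* π) :* (t :* s'))
             refl a π t t' s' ⟩
      (π *R t +R (a *R (π *R t') +R (π *R t) *R 0R)) +R (π *R π) *R (t *R s')
        ≡⟨ π²-vanishes _ _ ⟩
      π *R t +R (a *R (π *R t') +R (π *R t) *R 0R)
        ∎

  -- If Z(g) = g m - m, m = (x, y), for g = (1, π; 0, 1) and g = (a, 0; 0, 1 - π),
  -- then the first gives π = πy and the second πy = 0.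
  Z-not-coboundary : (G : M2 → Set) (a : R) → G (mat 1R π 0R 1R) → G (mat a 0R 0R (1R -R π)) →
                     ¬ π ≡ 0R → ¬ IsCoboundary G Z
  Z-not-coboundary G a G-unipotent G-diagonal π≢0 ((x , y) , Z≡δm) = π≢0 (trans π≡πy πy≡0)
    where
    π≡πy : π ≡ π *R y
    π≡πy = begin
      π                         ≡⟨ cong proj₁ (Z≡δm _ G-unipotent) ⟩
      (1R *R x +R π *R y) -R x  ≡⟨ cong (λ z → (z +R π *R y) -R x) (*R-identityˡ x) ⟩
      (x +R π *R y) -R x        ≡⟨ xyx⁻¹≈y x (π *R y) ⟩
      π *R y                    ∎
    -πy≡0 : -R (π *R y) ≡ 0R
    -πy≡0 = sym (begin
      0R                                ≡⟨ cong proj₂ (Z≡δm _ G-diagonal) ⟩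
      (0R *R x +R (1R -R π) *R y) -R y  ≡⟨ cong (_-R y) (solve 3 (λ x y -π → con 0 :* x :+ (con 1 :+ -π) :* y
                                                                    := y :+ -π :* y) refl x y (-R π)) ⟩
      (y +R (-R π) *R y) -R y           ≡⟨ xyx⁻¹≈y y _ ⟩
      (-R π) *R y                       ≡⟨ -‿distribˡ-* π y ⟨
      -R (π *R y)                       ∎)
    πy≡0 : π *R y ≡ 0R
    πy≡0 = trans (sym (-‿involutive _)) (trans (cong -R_ -πy≡0) -0#≈0#)

  δ-first-axis : ∀ a t s x → act (triangular a t s) (x , 0R) -V (x , 0R) ≡ ((a -R 1R) *R x , 0R)
  δ-first-axis a t s x = cong₂ _,_ first second
    where
    first : (a *R x +R (π *R t) *R 0R) -R x ≡ (a -R 1R) *R x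
    first = begin
      (a *R x +R (π *R t) *R 0R) +R -R x          ≡⟨ cong ((a *R x +R (π *R t) *R 0R) +R_) (-1*x≈-x x) ⟨
      (a *R x +R (π *R t) *R 0R) +R (-R 1R) *R x  ≡⟨ solve 4 (λ a x πt -one → (a :* x :+ πt :* con 0) :+ -one :* x
                                                        := (a :+ -one) :* x) refl a x (π *R t) (-R 1R) ⟩
      (a -R 1R) *R x                              ∎
    second : (0R *R x +R (1R +R π *R s) *R 0R) -R 0R ≡ 0R
    second = trans (cong ((0R *R x +R (1R +R π *R s) *R 0R) +R_) -0#≈0#)
                   (solve 2 (λ x d → (con 0 :* x :+ d :* con 0) :+ con 0 := con 0) refl x (1R +R π *R s))

  Z-local-d≡1 : ∀ a t s → Z (triangular a t (π *R s)) ≡ act (triangular a t (π *R s)) (0R , 1R) -V (0R , 1R)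
  Z-local-d≡1 a t s = sym (cong₂ _,_ first second)
    where
    first : (a *R 0R +R (π *R t) *R 1R) -R 0R ≡ π *R t
    first = trans (cong ((a *R 0R +R (π *R t) *R 1R) +R_) -0#≈0#)
                  (solve 2 (λ a πt → (a :* con 0 :+ πt :* con 1) :+ con 0 := πt) refl a (π *R t))
    second : (0R *R 0R +R (1R +R π *R (π *R s)) *R 1R) -R 1R ≡ 0R
    second = begin
      (0R *R 0R +R (1R +R π *R (π *R s)) *R 1R) +R -R 1R  ≡⟨ solve 3 (λ π s -one →
                                                               (con 0 :* con 0 :+ (con 1 :+ π :* (π :* s)) :* con 1) :+ -one
                                                               := (con 1 :+ -one) :+ (π :* π) :* s) refl π s (-R 1R) ⟩
      (1R +R -R 1R) +R (π *R π) *R s                       ≡⟨ π²-vanishes _ _ ⟩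
      1R +R -R 1R                                          ≡⟨ -R-inverseʳ 1R ⟩
      0R                                                   ∎

  Z-local-a-1-unit : ∀ a t s w → (a -R 1R) *R w ≡ 1R →
                     Z (triangular a t s) ≡ act (triangular a t s) (π *R t *R w , 0R) -V (π *R t *R w , 0R)
  Z-local-a-1-unit a t s w [a-1]w≡1 = sym (trans (δ-first-axis a t s (π *R t *R w)) (cong (_, 0R) (begin
    (a -R 1R) *R (π *R t *R w)  ≡⟨ solve 3 (λ a-1 πt w → a-1 :* (πt :* w) := (a-1 :* w) :* πt) refl (a -R 1R) (π *R t) w ⟩
    ((a -R 1R) *R w) *R (π *R t) ≡⟨ cong (_*R (π *R t)) [a-1]w≡1 ⟩
    1R *R (π *R t)              ≡⟨ *R-identityˡ (π *R t) ⟩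
    π *R t                      ∎)))

  Z-local-a-1≡πr : ∀ a t s r s' → a -R 1R ≡ π *R r → π *R r ≡ -R (π *R s) → s *R s' ≡ 1R →
                   Z (triangular a t s) ≡ act (triangular a t s) (-R (t *R s') , 0R) -V (-R (t *R s') , 0R)
  Z-local-a-1≡πr a t s r s' a-1≡πr πr≡-πs ss'≡1 = sym (trans (δ-first-axis a t s (-R (t *R s'))) (cong (_, 0R) (begin
    (a -R 1R) *R (-R (t *R s'))         ≡⟨ cong (_*R (-R (t *R s'))) (trans a-1≡πr πr≡-πs) ⟩
    (-R (π *R s)) *R (-R (t *R s'))     ≡⟨ -‿distribˡ-* (π *R s) _ ⟨
    -R ((π *R s) *R (-R (t *R s')))     ≡⟨ cong -R_ (-‿distribʳ-* (π *R s) _) ⟨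
    -R (-R ((π *R s) *R (t *R s')))     ≡⟨ -‿involutive _ ⟩
    (π *R s) *R (t *R s')               ≡⟨ solve 4 (λ π s t s' → (π :* s) :* (t :* s') := (π :* t) :* (s :* s')) refl π s t s' ⟩
    (π *R t) *R (s *R s')               ≡⟨ cong ((π *R t) *R_) ss'≡1 ⟩
    (π *R t) *R 1R                      ≡⟨ *-identityʳ (π *R t) ⟩
    π *R t                              ∎)))

  -- Z is locally trivial on Borel matrices when every element of ℤ/nℤ is a
  -- multiple of π or a unit and (k+1)π = 0.  For g = (a, πt; 0, 1 + πs):
  -- if π ∣ s then 1 + πs = 1; otherwise s is a unit, and either a - 1 is a
  -- unit or a = 1 + πr, in which case a(1 + πs) = 1 + π(r + s) is a k-th
  -- root of unity, so π(r + s) = 0.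
  Z-locally-trivial : (∀ x → π∣ x ⊎ IsUnit x) → [ suc k ] *R π ≡ 0R →
                      ∀ g → IsBorel g → ∃ λ m → Z g ≡ act g m -V m
  Z-locally-trivial local [k+1]π≡0 (mat a _ _ _) (borel refl (t , refl) (s , refl) _ root)
    with local s | local (a -R 1R)
  ... | inj₁ (s₂ , refl)  | _                   = (0R , 1R) , Z-local-d≡1 a t s₂
  ... | inj₂ _            | inj₂ (w , [a-1]w≡1) = (π *R t *R w , 0R) , Z-local-a-1-unit a t s w [a-1]w≡1
  ... | inj₂ (s' , ss'≡1) | inj₁ (r , a-1≡πr)   =
        (-R (t *R s') , 0R) , Z-local-a-1≡πr a t s r s' a-1≡πr πr≡-πs ss'≡1
    where
    1+πr≡a : 1R +R π *R r ≡ a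
    1+πr≡a = begin
      1R +R π *R r          ≡⟨ cong (1R +R_) a-1≡πr ⟨
      1R +R (a +R -R 1R)    ≡⟨ solve 2 (λ a -one → con 1 :+ (a :+ -one) := a :+ (con 1 :+ -one)) refl a (-R 1R) ⟩
      a +R (1R +R -R 1R)    ≡⟨ cong (a +R_) (-R-inverseʳ 1R) ⟩
      a +R 0R               ≡⟨ +-identityʳ a ⟩
      a                     ∎
    π[r+s]≡0 : π *R (r +R s) ≡ 0R
    π[r+s]≡0 = 1+π-root-trivial k (r +R s) [k+1]π≡0
                 (subst (IsRootOfUnity k) (trans (cong (_*R (1R +R π *R s)) (sym 1+πr≡a)) (1+π-*R r s)) root)
    πr≡-πs : π *R r ≡ -R (π *R s)
    πr≡-πs = +-inverseˡ-unique (π *R r) (π *R s) (trans (sym (*R-distribˡ π r s)) π[r+s]≡0)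

  H1loc-nonzero : (∀ x → π∣ x ⊎ IsUnit x) → [ suc k ] *R π ≡ 0R → ¬ π ≡ 0R →
                  (S : M2 → Set) (a : R) → (∀ g → S g → IsBorel g) →
                  S (mat 1R π 0R 1R) → S (mat a 0R 0R (1R -R π)) → H1loc≢0 (Gen S)
  H1loc-nonzero local [k+1]π≡0 π≢0 S a S⊆Borel S-unipotent S-diagonal =
    Z , (λ g h Gg Gh → Z-cocycle g h (borel-of Gg) (borel-of Gh))
      , (λ g Gg → Z-locally-trivial local [k+1]π≡0 g (borel-of Gg))
      , Z-not-coboundary (Gen S) a (gen S-unipotent) (gen S-diagonal) π≢0
    where
    borel-of : ∀ {g} → Gen S g → IsBorel g
    borel-of = generated-borel S S⊆Borel _

module PSquared (p : ℕ) (pr : Prime p) where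
  open Lemma10Setup p pr
  private instance
    p²-nonZero : NonZero (p ℕ.* p)
    p²-nonZero = prime⇒sq-nonZero pr
  open ZModRing (p ℕ.* p)
  open ≡-Reasoning

  P : R
  P = [ p ]

  P²≡0 : P *R P ≡ 0R
  P²≡0 = trans ([]-homo-* p p) [n]≡0

  open SquareZero (p ℕ.* p) P P²≡0
  open BorelCocycle (p ℕ.* p) P P²≡0 (p ∸ 1)

  p>1 : 1 ℕ.< p
  p>1 = ℕ.nonTrivial⇒n>1 p {{prime⇒nonTrivial pr}}

  -- p is nonzero in ℤ/p²ℤ since 0 < p < p².
  P≢0 : ¬ P ≡ 0R
  P≢0 P≡0 = ℕ.<⇒≢ (ℕ.<-trans (ℕ.s≤s ℕ.z≤n) p>1) (sym (begin
    p                ≡⟨ m<n⇒m%n≡m (ℕ.m<m*n p p {{prime⇒nonZero pr}} p>1) ⟨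
    p % (p ℕ.* p)    ≡⟨ toℕ-[] p ⟨
    toℕ P            ≡⟨ cong toℕ P≡0 ⟩
    toℕ 0R           ≡⟨ toℕ-[] 0 ⟩
    0 % (p ℕ.* p)    ≡⟨ m*n%n≡0 0 (p ℕ.* p) ⟩
    0                ∎))

  -- p · p = 0, written with p = (p - 1) + 1 as needed for roots of unity of order p - 1.
  [p-1+1]P≡0 : [ suc (p ∸ 1) ] *R P ≡ 0R
  [p-1+1]P≡0 = trans (cong (λ m → [ m ] *R P) (ℕ.m+[n∸m]≡n (ℕ.<⇒≤ p>1))) P²≡0

  *R-residue : ∀ x a → x *R [ a ] ≡ [ a ℕ.* toℕ x ]
  *R-residue x a = begin
    x *R [ a ]              ≡⟨ cong (_*R [ a ]) ([]-toℕ x) ⟨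
    [ toℕ x ] *R [ a ]      ≡⟨ []-homo-* (toℕ x) a ⟩
    [ toℕ x ℕ.* a ]         ≡⟨ cong [_] (ℕ.*-comm (toℕ x) a) ⟩
    [ a ℕ.* toℕ x ]         ∎

  residue-*p : ∀ b → [ b ℕ.* p ] ≡ P *R [ b ]
  residue-*p b = trans (sym ([]-homo-* b p)) (*R-comm [ b ] P)

  Bézout⇒unit : ∀ x → Bézout.Identity 1 (toℕ x) p → IsUnit x
  Bézout⇒unit x (Bézout.+- a b 1+bp≡ax) = unit-mod-π x [ a ] [ b ] (begin
    x *R [ a ]          ≡⟨ *R-residue x a ⟩
    [ a ℕ.* toℕ x ]     ≡⟨ cong [_] 1+bp≡ax ⟨
    [ 1 ℕ.+ b ℕ.* p ]   ≡⟨ []-homo-+ 1 (b ℕ.* p) ⟨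
    1R +R [ b ℕ.* p ]   ≡⟨ cong (1R +R_) (residue-*p b) ⟩
    1R +R P *R [ b ]    ∎)
  Bézout⇒unit x (Bézout.-+ a b 1+ax≡bp) = unit-mod-π x (-R [ a ]) (-R [ b ]) (begin
    x *R (-R [ a ])           ≡⟨ -‿distribʳ-* x [ a ] ⟨
    -R (x *R [ a ])           ≡⟨ +-inverseʳ-unique (x *R [ a ]) _ xa+[1-Pb]≡0 ⟨
    1R +R P *R (-R [ b ])     ∎)
    where
    1+xa≡Pb : 1R +R x *R [ a ] ≡ P *R [ b ]
    1+xa≡Pb = begin
      1R +R x *R [ a ]        ≡⟨ cong (1R +R_) (*R-residue x a) ⟩
      1R +R [ a ℕ.* toℕ x ]   ≡⟨ []-homo-+ 1 (a ℕ.* toℕ x) ⟩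
      [ 1 ℕ.+ a ℕ.* toℕ x ]   ≡⟨ cong [_] 1+ax≡bp ⟩
      [ b ℕ.* p ]             ≡⟨ residue-*p b ⟩
      P *R [ b ]              ∎
    xa+[1-Pb]≡0 : x *R [ a ] +R (1R +R P *R (-R [ b ])) ≡ 0R
    xa+[1-Pb]≡0 = begin
      x *R [ a ] +R (1R +R P *R (-R [ b ]))    ≡⟨ solve 2 (λ xa Q → xa :+ (con 1 :+ Q) := (con 1 :+ xa) :+ Q)
                                                      refl (x *R [ a ]) (P *R (-R [ b ])) ⟩
      (1R +R x *R [ a ]) +R P *R (-R [ b ])    ≡⟨ cong₂ _+R_ 1+xa≡Pb (sym (-‿distribʳ-* P [ b ])) ⟩
      P *R [ b ] +R -R (P *R [ b ])            ≡⟨ -R-inverseʳ (P *R [ b ]) ⟩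
      0R                                       ∎

  -- ℤ/p²ℤ is local with maximal ideal pℤ/p²ℤ: each element is a multiple of
  -- p or, being prime to p, a unit.
  multiple-of-P-or-unit : ∀ x → π∣ x ⊎ IsUnit x
  multiple-of-P-or-unit x with p ∣? toℕ x
  ... | yes (divides b x≡bp) = inj₁ ([ b ] , trans (sym ([]-toℕ x)) (trans (cong [_] x≡bp) (residue-*p b)))
  ... | no p∤x = inj₂ (Bézout⇒unit x (coprime-Bézout x⊥p))
    where
    x⊥p : Coprime (toℕ x) p
    x⊥p (d∣x , d∣p) with prime⇒irreducible pr d∣p
    ... | inj₁ d≡1  = d≡1
    ... | inj₂ refl = ⊥-elim (p∤x d∣x)

  generators-Borel : ∀ l → IsUnit l → IsRootOfUnity (p ∸ 1) l → ∀ g → Gens l g → IsBorel g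
  generators-Borel l l-unit l-root _ (inj₁ refl) =
    borel refl (0R , sym (zeroʳ P)) (0R , sym 1+π0≡1) l-unit (subst (IsRootOfUnity (p ∸ 1)) (sym (*-identityʳ l)) l-root)
  generators-Borel l l-unit l-root _ (inj₂ (inj₁ refl)) =
    borel refl (0R , sym (zeroʳ P)) (-R 1R , 1-P≡1+P[-1]) (unit-mod-π [ 1 ℕ.+ p ] (1R -R P) 0R [1+p][1-p]≡1+P0)
          (subst (IsRootOfUnity (p ∸ 1)) (sym (trans [1+p][1-p]≡1+P0 1+π0≡1)) (1^R (p ∸ 1)))
    where
    1-P≡1+P[-1] : 1R -R P ≡ 1R +R P *R (-R 1R)
    1-P≡1+P[-1] = cong (1R +R_) (trans (sym (-1*x≈-x P)) (*R-comm (-R 1R) P))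
    [1+p][1-p]≡1+P0 : [ 1 ℕ.+ p ] *R (1R -R P) ≡ 1R +R P *R 0R
    [1+p][1-p]≡1+P0 = begin
      [ 1 ℕ.+ p ] *R (1R -R P)                 ≡⟨ cong₂ _*R_ ([]-homo-+ 1 p) (sym 1-P≡1+P[-1]) ⟨
      (1R +R P) *R (1R +R P *R (-R 1R))        ≡⟨ cong (λ z → (1R +R z) *R (1R +R P *R (-R 1R))) (*-identityʳ P) ⟨
      (1R +R P *R 1R) *R (1R +R P *R (-R 1R))  ≡⟨ 1+π-*R 1R (-R 1R) ⟩
      1R +R P *R (1R +R -R 1R)                 ≡⟨ cong (λ z → 1R +R P *R z) (-R-inverseʳ 1R) ⟩
      1R +R P *R 0R                            ∎
  generators-Borel l l-unit l-root _ (inj₂ (inj₂ refl)) =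
    borel refl (1R , sym (*-identityʳ P)) (0R , sym 1+π0≡1) (1R , *R-identityˡ 1R)
          (trans (cong (_^R (p ∸ 1)) (*R-identityˡ 1R)) (1^R (p ∸ 1)))

lemma10 : (p : ℕ) (pr : Prime p) → let open Lemma10Setup p pr in
          (l : R) → IsUnit l → l ^R (p ∸ 1) ≡ 1R →
          H1loc≢0 (Gen (Gens l))
lemma10 p pr l l-unit l-root =
  H1loc-nonzero multiple-of-P-or-unit [p-1+1]P≡0 P≢0
                (Gens l) [ 1 ℕ.+ p ] (generators-Borel l l-unit l-root)
                (inj₂ (inj₂ refl)) (inj₂ (inj₁ refl))
  where
  open Lemma10Setup p pr
  open PSquared p pr
  open BorelCocycle (p ℕ.* p) {{prime⇒sq-nonZero pr}} P P²≡0 (p ∸ 1)
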